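{- Let $n\ge3$. Then $W^{n-1}_{n-1}=W^{n-2}_{n-2}\cup W^{n-2}_{n-2}\,w_{n-1}$, where $W^{n-2}_{n-2}\subset S_{n-1}$ is embedded in $S_n$ as permutations of $\{2,\dots,n\}$ fixing $1$ (via $\sigma\mapsto\sigma'$, $\sigma'(1)=1$, $\sigma'(i+1)=\sigma(i)+1$), and $w_{n-1}\in S_n$ is the longest element, $w_{n-1}(i)=n+1-i$.
   Context: For $k\ge1$, type $A_k$: $\alpha_{i,j}=e_i-e_j$, simple roots $\alpha_i=\alpha_{i,i+1}$; $S_{k+1}$ acts by $e_a\mapsto e_{w(a)}$, $|\beta|$ is whichever of $\pm\beta$ is positive; $C(S)=\sum_{\alpha\in S}\mathbb{R}_{\ge0}\alpha$. $\mathfrak{a}^k_k=C(\alpha_{k,k+1},\alpha_{k-1,k+1},\dots,\alpha_{1,k+1})=\{\sum a_i\alpha_i:0\le a_1\le\cdots\le a_k\}$ and $W^k_k=\{w\in S_{k+1}:(\mathfrak{a}^k_k)^\circ\subset C(|w\alpha_1|,\dots,|w\alpha_k|)\}$, with interior taken in $\{x\in\mathbb{R}^{k+1}:\sum x_i=0\}$.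
   Formalization: In the definition of $W^k_k$, points have rational coordinates and the cone coefficients and interior radii are rational rather than real. -}

module Defs where

open import Data.Nat using (ℕ; zero; suc; _<ᵇ_)
open import Data.Fin using (Fin; zero; suc; inject₁; fromℕ; toℕ; opposite; _≟_)
open import Data.Fin.Permutation using (Permutation′; _⟨$⟩ʳ_)
open import Data.Rational using (ℚ; 0ℚ; 1ℚ; _+_; _*_; _-_; _≤_; _<_; ∣_∣)
open import Data.Bool using (if_then_else_)
open import Data.Product using (Σ; _×_; ∃)
open import Relation.Nullary using (does)
open import Relation.Binary.PropositionalEquality using (_≡_)

-- vectors in ℚ^(d) as functions (coordinates 0-indexed: Fin index a stands for e_{a+1})
Vec : ℕ → Set
Vec d = Fin d → ℚ

∑ : (r : ℕ) → (Fin r → ℚ) → ℚ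
∑ zero    f = 0ℚ
∑ (suc r) f = f zero + ∑ r (λ i → f (suc i))

e : ∀ {d} → Fin d → Vec d
e a b = if does (a ≟ b) then 1ℚ else 0ℚ

rt : ∀ {d} → Fin d → Fin d → Vec d
rt a b x = e a x - e b x

-- |α_{a,b}| : whichever of ±α_{a,b} is positive (positive roots are α_{a,b}, a < b)
absRt : ∀ {d} → Fin d → Fin d → Vec d
absRt a b = if toℕ a <ᵇ toℕ b then rt a b else rt b a

InCone : ∀ {d} (r : ℕ) → (Fin r → Vec d) → Vec d → Set
InCone {d} r g x =
  Σ (Fin r → ℚ) λ c → ((i : Fin r) → 0ℚ ≤ c i) × ((b : Fin d) → x b ≡ ∑ r (λ i → c i * g i b))

InH : ∀ {d} → Vec d → Set
InH {d} x = ∑ d x ≡ 0ℚ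

InInterior : ∀ {d} → (Vec d → Set) → Vec d → Set
InInterior {d} S x =
  InH x × ∃ λ (ε : ℚ) → (0ℚ < ε) ×
    ((y : Vec d) → InH y → ((b : Fin d) → ∣ y b - x b ∣ < ε) → S y)

𝔞 : (k : ℕ) → Vec (suc k) → Set
𝔞 k = InCone k (λ j → rt (inject₁ j) (fromℕ k))

-- simple root α_i, i = 1..k (Fin k index j ↦ α_{j+1})
-- |w α_i| = |α_{w(i), w(i+1)}|
absWα : ∀ {k} → Permutation′ (suc k) → Fin k → Vec (suc k)
absWα w j = absRt (w ⟨$⟩ʳ inject₁ j) (w ⟨$⟩ʳ suc j)

W : (k : ℕ) → Permutation′ (suc k) → Set
W k w = (x : Vec (suc k)) → InInterior (𝔞 k) x → InCone k (absWα w) x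

embed : ∀ {m} → Permutation′ m → Fin (suc m) → Fin (suc m)
embed σ zero    = zero
embed σ (suc i) = suc (σ ⟨$⟩ʳ i)

w₀ : ∀ {n} → Fin n → Fin n
w₀ = opposite

{-# OPTIONS --safe #-}
-- Over ℚ the interior of 𝔞 = C(e₁ − e_{k+1}, …, e_k − e_{k+1}) is {x ∈ H : x₁, …, x_k > 0}, and
-- |wα₁|, …, |wα_k| are the edges |e_{w(i)} − e_{w(i+1)}| of the path w(1), …, w(k+1); reversing
-- the path (w ↦ w w_k) does not change this set of roots.  If w(1) = 1, an interior point x splits
-- as x₁ (e₁ − e_{w(2)}) + (0, y) with y interior for the path w(2), …, w(k+1), and the first
-- coordinate of any cone representation of x forces the coefficient of e₁ − e_{w(2)} to be x₁;
-- so w ∈ W^k_k iff that shorter path covers.  It remains to see that 1 is an end of the path: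
-- if w(p) = 1 with 1 < p < k+1, let T be the coordinates visited on the side of p away from k+1.
-- The functional Σ_{b∈T} x_b is ≤ 0 on every |wα_i| (only the edge into 1 changes its value, and
-- that edge is e₁ − e_b), but it is positive at the interior point (1, …, 1, −k).
module Submission where

open import Defs

module Cones where
  open import Algebra.Bundles using (CommutativeRing)
  open import Data.Bool using (true; false; if_then_else_; T)
  open import Data.Empty using (⊥-elim)
  open import Data.Fin as Fin using (Fin; zero; suc; inject₁; fromℕ; toℕ; opposite; lift; _≟_)
  import Data.Fin.Properties as Finₚ
  open import Data.Fin.Relation.Unary.Top using (view; ‵fromℕ; ‵inject₁)
  open import Data.Nat as ℕ using (zero; suc)
  import Data.Nat.Properties as ℕₚ
  open import Data.Product using (_,_; ∃; _×_; proj₁)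
  open import Data.Rational using (ℚ; 0ℚ; 1ℚ; _+_; _*_; _-_; -_; _≤_; _<_; ∣_∣; nonNegative)
  import Data.Rational.Properties as ℚₚ
  open import Data.Rational.Solver using (module +-*-Solver)
  open import Algebra.Properties.Group ℚₚ.+-0-group using (inverseʳ-unique)
  open import Data.Sum using (_⊎_; inj₁; inj₂)
  open import Data.Unit using (tt)
  open import Data.Vec.Functional using (_∷_)
  open import Function using (_∘_)
  open import Relation.Binary.Definitions using (tri<; tri≈; tri>)
  open import Relation.Binary.PropositionalEquality
    using (_≡_; _≢_; refl; sym; trans; cong; cong₂; subst; subst₂; cong-app; _≗_; module ≡-Reasoning)
  open import Relation.Nullary using (¬_; does; yes; no)
  open import Relation.Nullary.Decidable using (dec-true; dec-false)
  open import Algebra.Properties.Semiring.Sum (CommutativeRing.semiring ℚₚ.+-*-commutativeRing)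
    using (sum; sum-cong-≗; ∑-distrib-+; *-distribˡ-sum; sum-permute; sum-init-last)
    renaming (∑-comm to sum-comm)
  open import Data.Fin.Permutation using (Permutation′; _⟨$⟩ʳ_; _⟨$⟩ˡ_; inverseˡ; inverseʳ; reverse; _∘ₚ_)
  open +-*-Solver using (solve; _:=_; _:+_; _:*_; _:-_; :-_; con)
  open ≡-Reasoning

  p≤∣p∣ : ∀ p → p ≤ ∣ p ∣
  p≤∣p∣ p with ℚₚ.≤-total p 0ℚ
  ... | inj₁ p≤0 = ℚₚ.≤-trans p≤0 (ℚₚ.0≤∣p∣ p)
  ... | inj₂ p≥0 = ℚₚ.≤-reflexive (sym (ℚₚ.0≤p⇒∣p∣≡p p≥0))

  p≡q⇒p-q≡0 : ∀ {p q} → p ≡ q → p - q ≡ 0ℚ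
  p≡q⇒p-q≡0 {p} refl = ℚₚ.+-inverseʳ p

  p<q⇒0<q-p : ∀ {p q} → p < q → 0ℚ < q - p
  p<q⇒0<q-p {p} {q} p<q = subst (_< q - p) (ℚₚ.+-inverseʳ p) (ℚₚ.+-monoˡ-< (- p) p<q)

  ∣q-p∣<p⇒0<q : ∀ {p q} → ∣ q - p ∣ < p → 0ℚ < q
  ∣q-p∣<p⇒0<q {p} {q} ∣q-p∣<p = subst (0ℚ <_) (solve 2 (λ p q → p :- (p :- q) := q) refl p q) (p<q⇒0<q-p p-q<p)
    where
    p-q≤∣q-p∣ : p - q ≤ ∣ q - p ∣
    p-q≤∣q-p∣ = subst₂ _≤_ (solve 2 (λ p q → :- (q :- p) := p :- q) refl p q) (ℚₚ.∣-p∣≡∣p∣ (q - p)) (p≤∣p∣ (- (q - p)))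
    p-q<p : p - q < p
    p-q<p = ℚₚ.≤-<-trans p-q≤∣q-p∣ ∣q-p∣<p

  *-nonneg : ∀ {p q} → 0ℚ ≤ p → 0ℚ ≤ q → 0ℚ ≤ p * q
  *-nonneg {p} {q} p≥0 q≥0 =
    ℚₚ.nonNegative⁻¹ _ {{ℚₚ.nonNeg*nonNeg⇒nonNeg p {{nonNegative p≥0}} q {{nonNegative q≥0}}}}

  *-nonneg-nonpos : ∀ {p q} → 0ℚ ≤ p → q ≤ 0ℚ → p * q ≤ 0ℚ
  *-nonneg-nonpos {p} {q} p≥0 q≤0 =
    ℚₚ.≤-trans (ℚₚ.*-monoˡ-≤-nonNeg p {{nonNegative p≥0}} q≤0) (ℚₚ.≤-reflexive (ℚₚ.*-zeroʳ p))

  ∑≡sum : ∀ r (f : Fin r → ℚ) → ∑ r f ≡ sum f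
  ∑≡sum zero    f = refl
  ∑≡sum (suc r) f = cong (f zero +_) (∑≡sum r (f ∘ suc))

  ∑-cong : ∀ r {f g : Fin r → ℚ} → f ≗ g → ∑ r f ≡ ∑ r g
  ∑-cong r {f} {g} f≗g = begin
    ∑ r f ≡⟨ ∑≡sum r f ⟩
    sum f ≡⟨ sum-cong-≗ f≗g ⟩
    sum g ≡⟨ ∑≡sum r g ⟨
    ∑ r g ∎

  ∑-zeros : ∀ r → ∑ r (λ _ → 0ℚ) ≡ 0ℚ
  ∑-zeros zero    = refl
  ∑-zeros (suc r) = cong (0ℚ +_) (∑-zeros r)

  ∑-*ˡ : ∀ r s (f : Fin r → ℚ) → ∑ r (λ i → s * f i) ≡ s * ∑ r f
  ∑-*ˡ r s f = begin
    ∑ r (λ i → s * f i) ≡⟨ ∑≡sum r _ ⟩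
    sum (λ i → s * f i) ≡⟨ *-distribˡ-sum s f ⟨
    s * sum f           ≡⟨ cong (s *_) (∑≡sum r f) ⟨
    s * ∑ r f           ∎

  ∑-+-* : ∀ r (f g : Fin r → ℚ) s → ∑ r (λ i → f i + s * g i) ≡ ∑ r f + s * ∑ r g
  ∑-+-* r f g s = begin
    ∑ r (λ i → f i + s * g i)        ≡⟨ ∑≡sum r _ ⟩
    sum (λ i → f i + s * g i)        ≡⟨ ∑-distrib-+ f (λ i → s * g i) ⟩
    sum f + sum (λ i → s * g i)      ≡⟨ cong₂ _+_ (∑≡sum r f) (∑≡sum r _) ⟨
    ∑ r f + ∑ r (λ i → s * g i)      ≡⟨ cong (∑ r f +_) (∑-*ˡ r s g) ⟩
    ∑ r f + s * ∑ r g                ∎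

  ∑-comm : ∀ r t (f : Fin r → Fin t → ℚ) → ∑ r (λ i → ∑ t (f i)) ≡ ∑ t (λ j → ∑ r (λ i → f i j))
  ∑-comm r t f = begin
    ∑ r (λ i → ∑ t (f i))             ≡⟨ ∑-cong r (λ i → ∑≡sum t (f i)) ⟩
    ∑ r (λ i → sum (f i))             ≡⟨ ∑≡sum r _ ⟩
    sum (λ i → sum (f i))             ≡⟨ sum-comm f ⟩
    sum (λ j → sum (λ i → f i j))     ≡⟨ ∑≡sum t _ ⟨
    ∑ t (λ j → sum (λ i → f i j))     ≡⟨ ∑-cong t (λ j → ∑≡sum r (λ i → f i j)) ⟨
    ∑ t (λ j → ∑ r (λ i → f i j))     ∎

  ∑-reverse : ∀ r (f : Fin r → ℚ) → ∑ r f ≡ ∑ r (f ∘ opposite)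
  ∑-reverse r f = begin
    ∑ r f              ≡⟨ ∑≡sum r f ⟩
    sum f              ≡⟨ sum-permute f reverse ⟩
    sum (f ∘ opposite) ≡⟨ ∑≡sum r (f ∘ opposite) ⟨
    ∑ r (f ∘ opposite) ∎

  ∑-init-last : ∀ r (f : Fin (suc r) → ℚ) → ∑ (suc r) f ≡ ∑ r (f ∘ inject₁) + f (fromℕ r)
  ∑-init-last r f = begin
    ∑ (suc r) f                  ≡⟨ ∑≡sum (suc r) f ⟩
    sum f                          ≡⟨ sum-init-last f ⟩
    sum (f ∘ inject₁) + f (fromℕ r) ≡⟨ cong (_+ f (fromℕ r)) (∑≡sum r (f ∘ inject₁)) ⟨
    ∑ r (f ∘ inject₁) + f (fromℕ r) ∎

  ∑-nonneg : ∀ r {f : Fin r → ℚ} → (∀ i → 0ℚ ≤ f i) → 0ℚ ≤ ∑ r f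
  ∑-nonneg zero    f≥0 = ℚₚ.≤-refl
  ∑-nonneg (suc r) f≥0 = ℚₚ.+-mono-≤ (f≥0 zero) (∑-nonneg r (f≥0 ∘ suc))

  ∑-nonpos : ∀ r {f : Fin r → ℚ} → (∀ i → f i ≤ 0ℚ) → ∑ r f ≤ 0ℚ
  ∑-nonpos zero    f≤0 = ℚₚ.≤-refl
  ∑-nonpos (suc r) f≤0 = ℚₚ.+-mono-≤ (f≤0 zero) (∑-nonpos r (f≤0 ∘ suc))

  ∑-pos : ∀ r {f : Fin r → ℚ} → (∀ i → 0ℚ ≤ f i) → ∀ i → 0ℚ < f i → 0ℚ < ∑ r f
  ∑-pos (suc r) f≥0 zero    f₀>0 = ℚₚ.+-mono-<-≤ f₀>0 (∑-nonneg r (f≥0 ∘ suc))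
  ∑-pos (suc r) f≥0 (suc i) fᵢ>0 = ℚₚ.+-mono-≤-< (f≥0 zero) (∑-pos r (f≥0 ∘ suc) i fᵢ>0)

  e-diag : ∀ {d} (a : Fin d) → e a a ≡ 1ℚ
  e-diag zero    = refl
  e-diag (suc a) = e-diag a

  e-≢ : ∀ {d} {a b : Fin d} → a ≢ b → e a b ≡ 0ℚ
  e-≢ {a = a} {b} a≢b with a ≟ b
  ... | yes a≡b = ⊥-elim (a≢b a≡b)
  ... | no _    = refl

  e-sym : ∀ {d} (a b : Fin d) → e a b ≡ e b a
  e-sym zero    zero    = refl
  e-sym zero    (suc b) = refl
  e-sym (suc a) zero    = refl
  e-sym (suc a) (suc b) = e-sym a b

  e-inject₁ : ∀ {d} (a b : Fin d) → e (inject₁ a) (inject₁ b) ≡ e a b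
  e-inject₁ zero    zero    = refl
  e-inject₁ zero    (suc b) = refl
  e-inject₁ (suc a) zero    = refl
  e-inject₁ (suc a) (suc b) = e-inject₁ a b

  e-fromℕ-inject₁ : ∀ {d} (j : Fin d) → e (fromℕ d) (inject₁ j) ≡ 0ℚ
  e-fromℕ-inject₁ j = e-≢ (Finₚ.fromℕ≢inject₁ {i = j})

  e-inject₁-fromℕ : ∀ {d} (j : Fin d) → e (inject₁ j) (fromℕ d) ≡ 0ℚ
  e-inject₁-fromℕ j = e-≢ (Finₚ.fromℕ≢inject₁ {i = j} ∘ sym)

  e-01 : ∀ {d} (a b : Fin d) → e a b ≡ 1ℚ ⊎ e a b ≡ 0ℚ
  e-01 a b with a ≟ b
  ... | yes _ = inj₁ refl
  ... | no _  = inj₂ refl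

  e-nonneg : ∀ {d} (a b : Fin d) → 0ℚ ≤ e a b
  e-nonneg a b with e-01 a b
  ... | inj₁ e≡1 = subst (0ℚ ≤_) (sym e≡1) (ℚₚ.<⇒≤ (ℚₚ.positive⁻¹ 1ℚ))
  ... | inj₂ e≡0 = ℚₚ.≤-reflexive (sym e≡0)

  ∑-*-e : ∀ r (f : Fin r → ℚ) a → ∑ r (λ i → f i * e a i) ≡ f a
  ∑-*-e (suc r) f zero = begin
    f zero * 1ℚ + ∑ r (λ i → f (suc i) * 0ℚ) ≡⟨ cong₂ _+_ (ℚₚ.*-identityʳ (f zero)) (∑-cong r (ℚₚ.*-zeroʳ ∘ f ∘ suc)) ⟩
    f zero + ∑ r (λ _ → 0ℚ)                   ≡⟨ cong (f zero +_) (∑-zeros r) ⟩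
    f zero + 0ℚ                               ≡⟨ ℚₚ.+-identityʳ (f zero) ⟩
    f zero                                    ∎
  ∑-*-e (suc r) f (suc a) = begin
    f zero * 0ℚ + ∑ r (λ i → f (suc i) * e a i) ≡⟨ cong₂ _+_ (ℚₚ.*-zeroʳ (f zero)) (∑-*-e r (f ∘ suc) a) ⟩
    0ℚ + f (suc a)                              ≡⟨ ℚₚ.+-identityˡ (f (suc a)) ⟩
    f (suc a)                                   ∎

  infix 7 _·_
  _·_ : ∀ {d} → Vec d → Vec d → ℚ
  _·_ {d} ψ x = ∑ d (λ b → ψ b * x b)

  ·-e : ∀ {d} (ψ : Vec d) a → ψ · e a ≡ ψ a
  ·-e {d} ψ = ∑-*-e d ψ

  ·-+-* : ∀ {d} (ψ x y : Vec d) s → ψ · (λ b → x b + s * y b) ≡ ψ · x + s * (ψ · y)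
  ·-+-* {d} ψ x y s = begin
    ∑ d (λ b → ψ b * (x b + s * y b))      ≡⟨ ∑-cong d (λ b → distrib (ψ b) (x b) (y b)) ⟩
    ∑ d (λ b → ψ b * x b + s * (ψ b * y b)) ≡⟨ ∑-+-* d _ _ s ⟩
    ψ · x + s * (ψ · y)                    ∎
    where
    distrib : ∀ p u v → p * (u + s * v) ≡ p * u + s * (p * v)
    distrib = solve 4 (λ s p u v → p :* (u :+ s :* v) := p :* u :+ s :* (p :* v)) refl s

  ·-rt : ∀ {d} (ψ : Vec d) a b → ψ · rt a b ≡ ψ a - ψ b
  ·-rt {d} ψ a b = begin
    ψ · rt a b                         ≡⟨ ∑-cong d (λ c → cong (ψ c *_) (minus (e a c) (e b c))) ⟩
    ψ · (λ c → e a c + - 1ℚ * e b c)   ≡⟨ ·-+-* ψ (e a) (e b) (- 1ℚ) ⟩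
    ψ · e a + - 1ℚ * (ψ · e b)         ≡⟨ cong₂ (λ u v → u + - 1ℚ * v) (·-e ψ a) (·-e ψ b) ⟩
    ψ a + - 1ℚ * ψ b                   ≡⟨ minus (ψ a) (ψ b) ⟨
    ψ a - ψ b                          ∎
    where
    minus : ∀ u v → u - v ≡ u + - 1ℚ * v
    minus = solve 2 (λ u v → u :- v := u :+ (:- con 1ℚ) :* v) refl

  ·-combination : ∀ {d r} (ψ x : Vec d) (c : Fin r → ℚ) (g : Fin r → Vec d) →
                  (∀ b → x b ≡ ∑ r (λ i → c i * g i b)) → ψ · x ≡ ∑ r (λ i → c i * (ψ · g i))
  ·-combination {d} {r} ψ x c g x≡ = begin
    ∑ d (λ b → ψ b * x b)                     ≡⟨ ∑-cong d (λ b → cong (ψ b *_) (x≡ b)) ⟩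
    ∑ d (λ b → ψ b * ∑ r (λ i → c i * g i b)) ≡⟨ ∑-cong d (λ b → sym (∑-*ˡ r (ψ b) _)) ⟩
    ∑ d (λ b → ∑ r (λ i → ψ b * (c i * g i b))) ≡⟨ ∑-comm d r _ ⟩
    ∑ r (λ i → ∑ d (λ b → ψ b * (c i * g i b))) ≡⟨ ∑-cong r (λ i → ∑-cong d (λ b → swap (ψ b) (c i) (g i b))) ⟩
    ∑ r (λ i → ∑ d (λ b → c i * (ψ b * g i b))) ≡⟨ ∑-cong r (λ i → ∑-*ˡ d (c i) _) ⟩
    ∑ r (λ i → c i * (ψ · g i))               ∎
    where
    swap : ∀ p q u → p * (q * u) ≡ q * (p * u)
    swap = solve 3 (λ p q u → p :* (q :* u) := q :* (p :* u)) refl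

  cone-·-nonpos : ∀ {d r} (ψ : Vec d) (g : Fin r → Vec d) {x} →
                  (∀ i → ψ · g i ≤ 0ℚ) → InCone r g x → ψ · x ≤ 0ℚ
  cone-·-nonpos {r = r} ψ g ψ·g≤0 (c , c≥0 , x≡) =
    subst (_≤ 0ℚ) (sym (·-combination ψ _ c g x≡)) (∑-nonpos r (λ i → *-nonneg-nonpos (c≥0 i) (ψ·g≤0 i)))

  ∑≡1· : ∀ {d} (x : Vec d) → ∑ d x ≡ (λ _ → 1ℚ) · x
  ∑≡1· {d} x = ∑-cong d (λ b → sym (ℚₚ.*-identityˡ (x b)))

  ∑-e : ∀ {d} (a : Fin d) → ∑ d (e a) ≡ 1ℚ
  ∑-e a = trans (∑≡1· (e a)) (·-e (λ _ → 1ℚ) a)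

  rt∈H : ∀ {d} (a b : Fin d) → InH (rt a b)
  rt∈H a b = trans (∑≡1· (rt a b)) (·-rt (λ _ → 1ℚ) a b)

  𝔞-coordinate : ∀ k (c : Fin k → ℚ) j → ∑ k (λ i → c i * rt (inject₁ i) (fromℕ k) (inject₁ j)) ≡ c j
  𝔞-coordinate k c j = trans (∑-cong k (λ i → cong (c i *_) (coordinate i))) (∑-*-e k c j)
    where
    coordinate : ∀ i → rt (inject₁ i) (fromℕ k) (inject₁ j) ≡ e j i
    coordinate i = begin
      e (inject₁ i) (inject₁ j) - e (fromℕ k) (inject₁ j) ≡⟨ cong₂ _-_ (e-inject₁ i j) (e-fromℕ-inject₁ j) ⟩
      e i j - 0ℚ                                         ≡⟨ ℚₚ.+-identityʳ (e i j) ⟩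
      e i j                                              ≡⟨ e-sym i j ⟩
      e j i                                              ∎

  𝔞-last : ∀ k (c : Fin k → ℚ) → ∑ k (λ i → c i * rt (inject₁ i) (fromℕ k) (fromℕ k)) ≡ - ∑ k c
  𝔞-last k c = begin
    ∑ k (λ i → c i * rt (inject₁ i) (fromℕ k) (fromℕ k)) ≡⟨ ∑-cong k (λ i → cong (c i *_) (coordinate i)) ⟩
    ∑ k (λ i → c i * - 1ℚ)                               ≡⟨ ∑-cong k (λ i → ℚₚ.*-comm (c i) (- 1ℚ)) ⟩
    ∑ k (λ i → - 1ℚ * c i)                               ≡⟨ ∑-*ˡ k (- 1ℚ) c ⟩
    - 1ℚ * ∑ k c                                         ≡⟨ solve 1 (λ s → (:- con 1ℚ) :* s := :- s) refl (∑ k c) ⟩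
    - ∑ k c                                              ∎
    where
    coordinate : ∀ i → rt (inject₁ i) (fromℕ k) (fromℕ k) ≡ - 1ℚ
    coordinate i = cong₂ _-_ (e-inject₁-fromℕ i) (e-diag (fromℕ k))

  𝔞-nonneg : ∀ {k} {x : Vec (suc k)} → 𝔞 k x → ∀ j → 0ℚ ≤ x (inject₁ j)
  𝔞-nonneg {k} (c , c≥0 , x≡) j = subst (0ℚ ≤_) (sym (trans (x≡ (inject₁ j)) (𝔞-coordinate k c j))) (c≥0 j)

  𝔞-intro : ∀ {k} {x : Vec (suc k)} → InH x → (∀ j → 0ℚ ≤ x (inject₁ j)) → 𝔞 k x
  𝔞-intro {k} {x} x∈H x≥0 = x ∘ inject₁ , x≥0 , coordinate
    where
    coordinate : ∀ b → x b ≡ ∑ k (λ i → x (inject₁ i) * rt (inject₁ i) (fromℕ k) b)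
    coordinate b with view b
    ... | ‵inject₁ j = sym (𝔞-coordinate k (x ∘ inject₁) j)
    ... | ‵fromℕ     = trans last≡ (sym (𝔞-last k (x ∘ inject₁)))
      where
      last≡ : x (fromℕ k) ≡ - ∑ k (x ∘ inject₁)
      last≡ = inverseʳ-unique (∑ k (x ∘ inject₁)) (x (fromℕ k)) (trans (sym (∑-init-last k x)) x∈H)

  ∣rt∣≤1 : ∀ {d} (a b c : Fin d) → ∣ rt a b c ∣ ≤ 1ℚ
  ∣rt∣≤1 a b c = bound (e-01 a c) (e-01 b c)
    where
    0≤1 : 0ℚ ≤ 1ℚ
    0≤1 = ℚₚ.<⇒≤ (ℚₚ.positive⁻¹ 1ℚ)
    bound : ∀ {u v} → u ≡ 1ℚ ⊎ u ≡ 0ℚ → v ≡ 1ℚ ⊎ v ≡ 0ℚ → ∣ u - v ∣ ≤ 1ℚ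
    bound (inj₁ refl) (inj₁ refl) = 0≤1
    bound (inj₁ refl) (inj₂ refl) = ℚₚ.≤-refl
    bound (inj₂ refl) (inj₁ refl) = ℚₚ.≤-refl
    bound (inj₂ refl) (inj₂ refl) = 0≤1

  ∃-lower-bound : ∀ {r} (f : Fin r → ℚ) → (∀ j → 0ℚ < f j) → ∃ λ t → 0ℚ < t × (∀ j → t < f j)
  ∃-lower-bound {zero} f f>0 = 1ℚ , ℚₚ.positive⁻¹ 1ℚ , λ ()
  ∃-lower-bound {suc r} f f>0 with ∃-lower-bound (f ∘ suc) (f>0 ∘ suc)
  ... | t , t>0 , t<f with f zero ℚₚ.≤? t
  ...   | no f₀≰t = t , t>0 , λ { zero → ℚₚ.≰⇒> f₀≰t ; (suc j) → t<f j }
  ...   | yes f₀≤t with ℚₚ.<-dense (f>0 zero)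
  ...     | s , s>0 , s<f₀ = s , s>0 , λ { zero → s<f₀ ; (suc j) → ℚₚ.<-trans s<f₀ (ℚₚ.≤-<-trans f₀≤t (t<f j)) }

  -- y = x − δ (e_j − e_{k+1}) is δ-close to x, so y ∈ 𝔞 and x_j = y_j + δ > 0.
  interior⇒positive : ∀ {k} {x : Vec (suc k)} → InInterior (𝔞 k) x → ∀ j → 0ℚ < x (inject₁ j)
  interior⇒positive {k} {x} (x∈H , ε , ε>0 , ball⊆𝔞) j with ℚₚ.<-dense ε>0
  ... | δ , δ>0 , δ<ε = subst (0ℚ <_) y+δ≡x (ℚₚ.+-mono-≤-< (𝔞-nonneg (ball⊆𝔞 y y∈H y-near) j) δ>0)
    where
    a = inject₁ j
    N = fromℕ k
    y : Vec (suc k)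
    y b = x b + δ * rt N a b
    y∈H : InH y
    y∈H = begin
      ∑ (suc k) y                    ≡⟨ ∑-+-* (suc k) x (rt N a) δ ⟩
      ∑ (suc k) x + δ * ∑ (suc k) (rt N a) ≡⟨ cong₂ (λ u v → u + δ * v) x∈H (rt∈H N a) ⟩
      0ℚ + δ * 0ℚ                      ≡⟨ solve 1 (λ δ → con 0ℚ :+ δ :* con 0ℚ := con 0ℚ) refl δ ⟩
      0ℚ                               ∎
    y-near : ∀ b → ∣ y b - x b ∣ < ε
    y-near b = ℚₚ.≤-<-trans (subst₂ _≤_ (sym ∣y-x∣≡) (ℚₚ.*-identityʳ δ) δ∣r∣≤δ1) δ<ε
      where
      r = rt N a b
      ∣y-x∣≡ : ∣ y b - x b ∣ ≡ δ * ∣ r ∣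
      ∣y-x∣≡ = begin
        ∣ y b - x b ∣ ≡⟨ cong ∣_∣ (solve 3 (λ u δ r → u :+ δ :* r :- u := δ :* r) refl (x b) δ r) ⟩
        ∣ δ * r ∣     ≡⟨ ℚₚ.∣p*q∣≡∣p∣*∣q∣ δ r ⟩
        ∣ δ ∣ * ∣ r ∣ ≡⟨ cong (_* ∣ r ∣) (ℚₚ.0≤p⇒∣p∣≡p (ℚₚ.<⇒≤ δ>0)) ⟩
        δ * ∣ r ∣     ∎
      δ∣r∣≤δ1 : δ * ∣ r ∣ ≤ δ * 1ℚ
      δ∣r∣≤δ1 = ℚₚ.*-monoˡ-≤-nonNeg δ {{nonNegative (ℚₚ.<⇒≤ δ>0)}} (∣rt∣≤1 N a b)
    y+δ≡x : y a + δ ≡ x a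
    y+δ≡x = begin
      x a + δ * (e N a - e a a) + δ ≡⟨ cong₂ (λ u v → x a + δ * (u - v) + δ) (e-fromℕ-inject₁ j) (e-diag a) ⟩
      x a + δ * (0ℚ - 1ℚ) + δ       ≡⟨ solve 2 (λ u δ → u :+ δ :* (con 0ℚ :- con 1ℚ) :+ δ := u) refl (x a) δ ⟩
      x a                           ∎

  positive⇒interior : ∀ {k} {x : Vec (suc k)} → InH x → (∀ j → 0ℚ < x (inject₁ j)) → InInterior (𝔞 k) x
  positive⇒interior {k} {x} x∈H x>0 with ∃-lower-bound (x ∘ inject₁) x>0
  ... | ε , ε>0 , ε<x = x∈H , ε , ε>0 , λ y y∈H y-near →
    𝔞-intro y∈H (λ j → ℚₚ.<⇒≤ (∣q-p∣<p⇒0<q (ℚₚ.<-trans (y-near (inject₁ j)) (ε<x j))))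

  absRoots : ∀ {k} → (Fin (suc k) → Fin (suc k)) → Fin k → Vec (suc k)
  absRoots f j = absRt (f (inject₁ j)) (f (suc j))

  Covers : ∀ k → (Fin (suc k) → Fin (suc k)) → Set
  Covers k f = ∀ x → InInterior (𝔞 k) x → InCone k (absRoots f) x

  InCone-resp : ∀ {d r} {g h : Fin r → Vec d} {x} → (∀ i → g i ≗ h i) → InCone r g x → InCone r h x
  InCone-resp {r = r} g≗h (c , c≥0 , x≡) = c , c≥0 , λ b → trans (x≡ b) (∑-cong r (λ i → cong (c i *_) (g≗h i b)))

  covers-resp : ∀ {k} {f g : Fin (suc k) → Fin (suc k)} → f ≗ g → Covers k f → Covers k g
  covers-resp f≗g cov x x° =
    InCone-resp (λ i b → cong₂ (λ u v → absRt u v b) (f≗g (inject₁ i)) (f≗g (suc i))) (cov x x°)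

  absRt-± : ∀ {d} (a b : Fin d) → absRt a b ≡ rt a b ⊎ absRt a b ≡ rt b a
  absRt-± a b with toℕ a ℕ.<ᵇ toℕ b
  ... | true  = inj₁ refl
  ... | false = inj₂ refl

  absRt-< : ∀ {d} {a b : Fin d} → toℕ a ℕ.< toℕ b → absRt a b ≡ rt a b
  absRt-< {a = a} {b} a<b with toℕ a ℕ.<ᵇ toℕ b in eq
  ... | true  = refl
  ... | false = ⊥-elim (subst T eq (ℕₚ.<⇒<ᵇ a<b))

  absRt-≮ : ∀ {d} {a b : Fin d} → ¬ toℕ a ℕ.< toℕ b → absRt a b ≡ rt b a
  absRt-≮ {a = a} {b} a≮b with toℕ a ℕ.<ᵇ toℕ b in eq
  ... | true  = ⊥-elim (a≮b (ℕₚ.<ᵇ⇒< (toℕ a) (toℕ b) (subst T (sym eq) tt)))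
  ... | false = refl

  absRt-sym : ∀ {d} (a b : Fin d) → absRt a b ≡ absRt b a
  absRt-sym a b with ℕₚ.<-cmp (toℕ a) (toℕ b)
  ... | tri< a<b _ b≮a = trans (absRt-< a<b) (sym (absRt-≮ b≮a))
  ... | tri≈ _ a≡b _   = cong₂ absRt (Finₚ.toℕ-injective a≡b) (sym (Finₚ.toℕ-injective a≡b))
  ... | tri> a≮b _ b<a = trans (absRt-≮ a≮b) (sym (absRt-< b<a))

  ·-absRt-≡ : ∀ {d} (ψ : Vec d) {a b} → ψ a ≡ ψ b → ψ · absRt a b ≡ 0ℚ
  ·-absRt-≡ ψ {a} {b} ψa≡ψb with absRt-± a b
  ... | inj₁ eq = trans (cong (ψ ·_) eq) (trans (·-rt ψ a b) (p≡q⇒p-q≡0 ψa≡ψb))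
  ... | inj₂ eq = trans (cong (ψ ·_) eq) (trans (·-rt ψ b a) (p≡q⇒p-q≡0 (sym ψa≡ψb)))

  opposite-inject₁ : ∀ {n} (i : Fin n) → opposite (inject₁ i) ≡ suc (opposite i)
  opposite-inject₁ i = begin
    opposite (inject₁ i)                       ≡⟨ cong (opposite ∘ inject₁) (Finₚ.opposite-involutive i) ⟨
    opposite (opposite (suc (opposite i)))     ≡⟨ Finₚ.opposite-involutive (suc (opposite i)) ⟩
    suc (opposite i)                           ∎

  opposite-< : ∀ {n} {i j : Fin n} → i Fin.< j → opposite j Fin.< opposite i
  opposite-< {n} {i} {j} i<j = subst₂ ℕ._<_ (sym (Finₚ.opposite-prop j)) (sym (Finₚ.opposite-prop i))
    (ℕₚ.∸-monoʳ-< (ℕ.s≤s i<j) (Finₚ.toℕ<n j))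

  absRoots-reverse : ∀ {k} (f : Fin (suc k) → Fin (suc k)) i → absRoots (f ∘ opposite) i ≡ absRoots f (opposite i)
  absRoots-reverse f i = trans (cong (λ u → absRt (f u) (f (inject₁ (opposite i)))) (opposite-inject₁ i))
                               (absRt-sym (f (suc (opposite i))) (f (inject₁ (opposite i))))

  InCone-reverse : ∀ {d r} {g : Fin r → Vec d} {x} → InCone r g x → InCone r (g ∘ opposite) x
  InCone-reverse {r = r} (c , c≥0 , x≡) = c ∘ opposite , c≥0 ∘ opposite , λ b → trans (x≡ b) (∑-reverse r _)

  covers-reverse : ∀ {k} {f : Fin (suc k) → Fin (suc k)} → Covers k f → Covers k (f ∘ opposite)
  covers-reverse {f = f} cov x x° =
    InCone-resp (λ i → cong-app (sym (absRoots-reverse f i))) (InCone-reverse (cov x x°))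

  absRt-suc-zero : ∀ {d} (u v : Fin d) → absRt (suc u) (suc v) zero ≡ 0ℚ
  absRt-suc-zero u v with toℕ u ℕ.<ᵇ toℕ v
  ... | true  = refl
  ... | false = refl

  absRt-suc : ∀ {d} (u v b : Fin d) → absRt (suc u) (suc v) (suc b) ≡ absRt u v b
  absRt-suc u v b with toℕ u ℕ.<ᵇ toℕ v
  ... | true  = refl
  ... | false = refl

  lift-absRoots-zero : ∀ {k} (f : Fin (suc k) → Fin (suc k)) (c : Fin (suc k) → ℚ) →
                       ∑ (suc k) (λ i → c i * absRoots (lift 1 f) i zero) ≡ c zero
  lift-absRoots-zero {k} f c = begin
    c zero * 1ℚ + ∑ k (λ i → c (suc i) * absRt (suc (f (inject₁ i))) (suc (f (suc i))) zero)
      ≡⟨ cong₂ _+_ (ℚₚ.*-identityʳ (c zero)) (∑-cong k vanish) ⟩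
    c zero + ∑ k (λ _ → 0ℚ) ≡⟨ cong (c zero +_) (∑-zeros k) ⟩
    c zero + 0ℚ             ≡⟨ ℚₚ.+-identityʳ (c zero) ⟩
    c zero                  ∎
    where
    vanish : ∀ i → c (suc i) * absRt (suc (f (inject₁ i))) (suc (f (suc i))) zero ≡ 0ℚ
    vanish i = trans (cong (c (suc i) *_) (absRt-suc-zero (f (inject₁ i)) (f (suc i)))) (ℚₚ.*-zeroʳ (c (suc i)))

  lift-absRoots-suc : ∀ {k} (f : Fin (suc k) → Fin (suc k)) (c : Fin (suc k) → ℚ) b →
                      ∑ (suc k) (λ i → c i * absRoots (lift 1 f) i (suc b))
                        ≡ ∑ k (λ i → c (suc i) * absRoots f i b) - c zero * e (f zero) b
  lift-absRoots-suc {k} f c b = begin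
    c zero * (0ℚ - E) + ∑ k (λ i → c (suc i) * absRt (suc (f (inject₁ i))) (suc (f (suc i))) (suc b))
      ≡⟨ cong (c zero * (0ℚ - E) +_) (∑-cong k shift) ⟩
    c zero * (0ℚ - E) + S ≡⟨ solve 3 (λ c E S → c :* (con 0ℚ :- E) :+ S := S :- c :* E) refl (c zero) E S ⟩
    S - c zero * E        ∎
    where
    E = e (f zero) b
    S = ∑ k (λ i → c (suc i) * absRoots f i b)
    shift : ∀ i → c (suc i) * absRt (suc (f (inject₁ i))) (suc (f (suc i))) (suc b) ≡ c (suc i) * absRoots f i b
    shift i = cong (c (suc i) *_) (absRt-suc (f (inject₁ i)) (f (suc i)) b)

  -- x = x₀ (e₀ − e_{1 + f 0}) + (0, y), and e₀ − e_{1 + f 0} is the first root of lift 1 f.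
  covers-lift : ∀ {k} {f : Fin (suc k) → Fin (suc k)} → Covers k f → Covers (suc k) (lift 1 f)
  covers-lift {k} {f} cov x x° = extend (cov y (positive⇒interior y∈H y>0))
    where
    x>0 = interior⇒positive x°
    x₀ = x zero
    y : Vec (suc k)
    y b = x (suc b) + x₀ * e (f zero) b
    y∈H : InH y
    y∈H = begin
      ∑ (suc k) y                                       ≡⟨ ∑-+-* (suc k) (x ∘ suc) (e (f zero)) x₀ ⟩
      ∑ (suc k) (x ∘ suc) + x₀ * ∑ (suc k) (e (f zero)) ≡⟨ cong (λ s → ∑ (suc k) (x ∘ suc) + x₀ * s) (∑-e (f zero)) ⟩
      ∑ (suc k) (x ∘ suc) + x₀ * 1ℚ                     ≡⟨ solve 2 (λ s x₀ → s :+ x₀ :* con 1ℚ := x₀ :+ s) refl _ x₀ ⟩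
      ∑ (suc (suc k)) x                                 ≡⟨ proj₁ x° ⟩
      0ℚ                                                ∎
    y>0 : ∀ j → 0ℚ < y (inject₁ j)
    y>0 j = ℚₚ.+-mono-<-≤ (x>0 (suc j)) x₀E≥0
      where
      x₀E≥0 : 0ℚ ≤ x₀ * e (f zero) (inject₁ j)
      x₀E≥0 = *-nonneg (ℚₚ.<⇒≤ (x>0 zero)) (e-nonneg (f zero) (inject₁ j))
    extend : InCone k (absRoots f) y → InCone (suc k) (absRoots (lift 1 f)) x
    extend (c , c≥0 , y≡) = x₀ ∷ c , c′≥0 , x≡
      where
      c′≥0 : ∀ i → 0ℚ ≤ (x₀ ∷ c) i
      c′≥0 zero    = ℚₚ.<⇒≤ (x>0 zero)
      c′≥0 (suc i) = c≥0 i
      x≡ : ∀ b → x b ≡ ∑ (suc k) (λ i → (x₀ ∷ c) i * absRoots (lift 1 f) i b)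
      x≡ zero    = sym (lift-absRoots-zero f (x₀ ∷ c))
      x≡ (suc b) = begin
        x (suc b)                                 ≡⟨ solve 3 (λ u a E → u := u :+ a :* E :- a :* E) refl (x (suc b)) x₀ E ⟩
        y b - x₀ * E                              ≡⟨ cong (_- x₀ * E) (y≡ b) ⟩
        ∑ k (λ i → c i * absRoots f i b) - x₀ * E ≡⟨ lift-absRoots-suc f (x₀ ∷ c) b ⟨
        ∑ (suc k) (λ i → (x₀ ∷ c) i * absRoots (lift 1 f) i (suc b)) ∎
        where
        E = e (f zero) b

  -- Pad y to x = t (e₀ − e_{1 + f 0}) + (0, y) with t small; in a cone representation of x
  -- only the first root has a non-zero first coordinate, so its coefficient is t.
  covers-unlift : ∀ {k} {f : Fin (suc k) → Fin (suc k)} → Covers (suc k) (lift 1 f) → Covers k f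
  covers-unlift {k} {f} cov y y° = unlift (∃-lower-bound (y ∘ inject₁) (interior⇒positive y°))
    where
    unlift : (∃ λ t → 0ℚ < t × (∀ j → t < y (inject₁ j))) → InCone k (absRoots f) y
    unlift (t , t>0 , t<y) = restrict (cov x (positive⇒interior x∈H x>0))
      where
      x : Vec (suc (suc k))
      x = t ∷ (λ b → y b + - t * e (f zero) b)
      x∈H : InH x
      x∈H = begin
        t + ∑ (suc k) (λ b → y b + - t * e (f zero) b)  ≡⟨ cong (t +_) (∑-+-* (suc k) y (e (f zero)) (- t)) ⟩
        t + (∑ (suc k) y + - t * ∑ (suc k) (e (f zero))) ≡⟨ cong₂ (λ s E → t + (s + - t * E)) (proj₁ y°) (∑-e (f zero)) ⟩
        t + (0ℚ + - t * 1ℚ)                              ≡⟨ solve 1 (λ t → t :+ (con 0ℚ :+ (:- t) :* con 1ℚ) := con 0ℚ) refl t ⟩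
        0ℚ                                               ∎
      x>0 : ∀ j → 0ℚ < x (inject₁ j)
      x>0 zero    = t>0
      x>0 (suc j) = padded>0 (e-01 (f zero) (inject₁ j))
        where
        yⱼ = y (inject₁ j)
        padded>0 : ∀ {E} → E ≡ 1ℚ ⊎ E ≡ 0ℚ → 0ℚ < yⱼ + - t * E
        padded>0 (inj₁ refl) = subst (0ℚ <_) (cong (yⱼ +_) (sym (ℚₚ.*-identityʳ (- t)))) (p<q⇒0<q-p (t<y j))
        padded>0 (inj₂ refl) = subst (0ℚ <_) (solve 2 (λ u t → u := u :+ (:- t) :* con 0ℚ) refl yⱼ t) (interior⇒positive y° j)
      restrict : InCone (suc k) (absRoots (lift 1 f)) x → InCone k (absRoots f) y
      restrict (c , c≥0 , x≡) = c ∘ suc , c≥0 ∘ suc , y≡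
        where
        c₀≡t : c zero ≡ t
        c₀≡t = sym (trans (x≡ zero) (lift-absRoots-zero f c))
        y≡ : ∀ b → y b ≡ ∑ k (λ i → c (suc i) * absRoots f i b)
        y≡ b = begin
          y b                    ≡⟨ solve 3 (λ u t E → u := u :+ (:- t) :* E :+ t :* E) refl (y b) t E ⟩
          x (suc b) + t * E      ≡⟨ cong (_+ t * E) (trans (x≡ (suc b)) (lift-absRoots-suc f c b)) ⟩
          S - c zero * E + t * E ≡⟨ cong (λ c₀ → S - c₀ * E + t * E) c₀≡t ⟩
          S - t * E + t * E      ≡⟨ solve 3 (λ S t E → S :- t :* E :+ t :* E := S) refl S t E ⟩
          S                      ∎
          where
          E = e (f zero) b
          S = ∑ k (λ i → c (suc i) * absRoots f i b)

  interior-𝔞⊈cone : ∀ {k r} (g : Fin r → Vec (suc k)) (ψ : Vec (suc k)) →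
                    (∀ b → 0ℚ ≤ ψ b) → ψ (fromℕ k) ≡ 0ℚ → ∀ b₀ → 0ℚ < ψ b₀ → (∀ i → ψ · g i ≤ 0ℚ) →
                    ¬ (∀ x → InInterior (𝔞 k) x → InCone r g x)
  interior-𝔞⊈cone {k} g ψ ψ≥0 ψN≡0 b₀ ψb₀>0 ψ·g≤0 covered =
    ℚₚ.<-irrefl refl (ℚₚ.<-≤-trans ψ·x>0 (cone-·-nonpos ψ g ψ·g≤0 (covered x (positive⇒interior x∈H x>0))))
    where
    N = fromℕ k
    K = ∑ (suc k) (λ _ → 1ℚ)
    x : Vec (suc k)
    x b = 1ℚ + - K * e N b
    x∈H : InH x
    x∈H = begin
      ∑ (suc k) x               ≡⟨ ∑-+-* (suc k) (λ _ → 1ℚ) (e N) (- K) ⟩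
      K + - K * ∑ (suc k) (e N) ≡⟨ cong (λ s → K + - K * s) (∑-e N) ⟩
      K + - K * 1ℚ                ≡⟨ solve 1 (λ K → K :+ (:- K) :* con 1ℚ := con 0ℚ) refl K ⟩
      0ℚ                          ∎
    x>0 : ∀ j → 0ℚ < x (inject₁ j)
    x>0 j = subst (0ℚ <_) (sym x≡1) (ℚₚ.positive⁻¹ 1ℚ)
      where
      x≡1 : x (inject₁ j) ≡ 1ℚ
      x≡1 = trans (cong (λ E → 1ℚ + - K * E) (e-fromℕ-inject₁ j))
                  (solve 1 (λ K → con 1ℚ :+ (:- K) :* con 0ℚ := con 1ℚ) refl K)
    ψ·x≡∑ψ : ψ · x ≡ ∑ (suc k) ψ
    ψ·x≡∑ψ = begin
      ψ · x                           ≡⟨ ·-+-* ψ (λ _ → 1ℚ) (e N) (- K) ⟩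
      ψ · (λ _ → 1ℚ) + - K * (ψ · e N) ≡⟨ cong (λ s → ψ · (λ _ → 1ℚ) + - K * s) (trans (·-e ψ N) ψN≡0) ⟩
      ψ · (λ _ → 1ℚ) + - K * 0ℚ        ≡⟨ solve 2 (λ s K → s :+ (:- K) :* con 0ℚ := s) refl _ K ⟩
      ψ · (λ _ → 1ℚ)                   ≡⟨ ∑-cong (suc k) (ℚₚ.*-identityʳ ∘ ψ) ⟩
      ∑ (suc k) ψ                    ∎
    ψ·x>0 : 0ℚ < ψ · x
    ψ·x>0 = subst (0ℚ <_) (sym ψ·x≡∑ψ) (∑-pos (suc k) ψ≥0 b₀ ψb₀>0)

  below : ∀ {n} → Fin n → Fin n → ℚ
  below p i = if does (i Fin.<? p) then 1ℚ else 0ℚ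

  below-< : ∀ {n} {p i : Fin n} → i Fin.< p → below p i ≡ 1ℚ
  below-< {p = p} {i} i<p = cong (λ t → if t then 1ℚ else 0ℚ) (dec-true (i Fin.<? p) i<p)

  below-≮ : ∀ {n} {p i : Fin n} → ¬ i Fin.< p → below p i ≡ 0ℚ
  below-≮ {p = p} {i} i≮p = cong (λ t → if t then 1ℚ else 0ℚ) (dec-false (i Fin.<? p) i≮p)

  below-nonneg : ∀ {n} (p i : Fin n) → 0ℚ ≤ below p i
  below-nonneg p i with i Fin.<? p
  ... | yes i<p = subst (0ℚ ≤_) (sym (below-< i<p)) (ℚₚ.<⇒≤ (ℚₚ.positive⁻¹ 1ℚ))
  ... | no i≮p  = ℚₚ.≤-reflexive (sym (below-≮ i≮p))

  before : ∀ {n} → Permutation′ n → Fin n → Vec n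
  before π p b = below p (π ⟨$⟩ˡ b)

  before-π : ∀ {n} (π : Permutation′ n) p i → before π p (π ⟨$⟩ʳ i) ≡ below p i
  before-π π p i = cong (below p) (inverseˡ π)

  -- Along the path, before π p only changes value at the edge into position p, which is e₀ − e_a.
  before-·-absRoots≤0 : ∀ {k} (π : Permutation′ (suc k)) {p} → π ⟨$⟩ʳ p ≡ zero →
                        ∀ j → before π p · absRoots (π ⟨$⟩ʳ_) j ≤ 0ℚ
  before-·-absRoots≤0 π {p} πp≡0 j with Finₚ.<-cmp (suc j) p
  ... | tri< j+1<p _ _ = ℚₚ.≤-reflexive (·-absRt-≡ (before π p) (begin
    before π p (π ⟨$⟩ʳ inject₁ j) ≡⟨ before-π π p (inject₁ j) ⟩
    below p (inject₁ j)           ≡⟨ below-< (Finₚ.<-trans (Finₚ.≤̄⇒inject₁< Finₚ.≤-refl) j+1<p) ⟩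
    1ℚ                            ≡⟨ below-< j+1<p ⟨
    below p (suc j)               ≡⟨ before-π π p (suc j) ⟨
    before π p (π ⟨$⟩ʳ suc j)     ∎))
  ... | tri> _ _ p<j+1 = ℚₚ.≤-reflexive (·-absRt-≡ (before π p) (begin
    before π p (π ⟨$⟩ʳ inject₁ j) ≡⟨ before-π π p (inject₁ j) ⟩
    below p (inject₁ j)           ≡⟨ below-≮ j≮p ⟩
    0ℚ                            ≡⟨ below-≮ (Finₚ.<-asym p<j+1) ⟨
    below p (suc j)               ≡⟨ before-π π p (suc j) ⟨
    before π p (π ⟨$⟩ʳ suc j)     ∎))
    where
    j≮p : ¬ inject₁ j Fin.< p
    j≮p j<p = ℕₚ.<⇒≱ j<p (subst (toℕ p ℕ.≤_) (sym (Finₚ.toℕ-inject₁ j)) (ℕ.s≤s⁻¹ p<j+1))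
  ... | tri≈ _ j+1≡p _ = subst (λ z → before π p · absRt a z ≤ 0ℚ) (sym πj+1≡0) ψ·root≤0
    where
    a = π ⟨$⟩ʳ inject₁ j
    πj+1≡0 : π ⟨$⟩ʳ suc j ≡ zero
    πj+1≡0 = trans (cong (π ⟨$⟩ʳ_) j+1≡p) πp≡0
    ψ₀≡0 : before π p zero ≡ 0ℚ
    ψ₀≡0 = trans (cong (before π p) (sym πp≡0)) (trans (before-π π p p) (below-≮ {p = p} {i = p} (Finₚ.<-irrefl refl)))
    ψ·root≤0 : before π p · absRt a zero ≤ 0ℚ
    ψ·root≤0 = subst (_≤ 0ℚ) (sym ψ·root≡) (ℚₚ.neg-antimono-≤ (below-nonneg p (π ⟨$⟩ˡ a)))
      where
      ψ·root≡ : before π p · absRt a zero ≡ - before π p a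
      ψ·root≡ = trans (·-rt (before π p) zero a) (trans (cong (_- before π p a) ψ₀≡0) (ℚₚ.+-identityˡ _))

  ¬covers-inner-zero : ∀ {k} (π : Permutation′ (suc k)) {p q} → π ⟨$⟩ʳ p ≡ zero → π ⟨$⟩ʳ q ≡ fromℕ k →
                       p ≢ zero → p Fin.< q → ¬ Covers k (π ⟨$⟩ʳ_)
  ¬covers-inner-zero π {p} {q} πp≡0 πq≡N p≢0 p<q =
    interior-𝔞⊈cone (absRoots (π ⟨$⟩ʳ_)) (before π p) (below-nonneg p ∘ (π ⟨$⟩ˡ_)) ψN≡0 (π ⟨$⟩ʳ zero) ψπ₀>0
                    (before-·-absRoots≤0 π πp≡0)
    where
    ψN≡0 : before π p (fromℕ _) ≡ 0ℚ
    ψN≡0 = trans (cong (before π p) (sym πq≡N)) (trans (before-π π p q) (below-≮ (Finₚ.<-asym p<q)))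
    ψπ₀>0 : 0ℚ < before π p (π ⟨$⟩ʳ zero)
    ψπ₀>0 = subst (0ℚ <_) (sym (trans (before-π π p zero) (below-< (Finₚ.≤∧≢⇒< ℕ.z≤n (p≢0 ∘ sym))))) (ℚₚ.positive⁻¹ 1ℚ)

  covers⇒zero-at-end : ∀ {k} (π : Permutation′ (suc (suc k))) → Covers (suc k) (π ⟨$⟩ʳ_) →
                       π ⟨$⟩ʳ zero ≡ zero ⊎ π ⟨$⟩ʳ fromℕ (suc k) ≡ zero
  covers⇒zero-at-end {k} π cov = at-end (π ⟨$⟩ˡ zero) (π ⟨$⟩ˡ N) (inverseʳ π) (inverseʳ π)
    where
    N = fromℕ (suc k)
    at-end : ∀ p q → π ⟨$⟩ʳ p ≡ zero → π ⟨$⟩ʳ q ≡ N → π ⟨$⟩ʳ zero ≡ zero ⊎ π ⟨$⟩ʳ N ≡ zero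
    at-end p q πp≡0 πq≡N with Finₚ.<-cmp p q
    at-end p q πp≡0 πq≡N | tri≈ _ refl _ with () ← trans (sym πp≡0) πq≡N
    at-end p q πp≡0 πq≡N | tri< p<q _ _ with p ≟ zero
    ... | yes refl = inj₁ πp≡0
    ... | no p≢0   = ⊥-elim (¬covers-inner-zero π πp≡0 πq≡N p≢0 p<q cov)
    at-end p q πp≡0 πq≡N | tri> _ _ q<p with opposite p ≟ zero
    ... | yes p̄≡0 = inj₂ (subst (λ i → π ⟨$⟩ʳ i ≡ zero) p≡N πp≡0)
      where
      p≡N : p ≡ N
      p≡N = trans (sym (Finₚ.opposite-involutive p)) (cong opposite p̄≡0)
    ... | no p̄≢0  = ⊥-elim (¬covers-inner-zero (reverse ∘ₚ π) (reversed πp≡0) (reversed πq≡N)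
                                               p̄≢0 (opposite-< q<p) (covers-reverse {f = π ⟨$⟩ʳ_} cov))
      where
      reversed : ∀ {i a} → π ⟨$⟩ʳ i ≡ a → (reverse ∘ₚ π) ⟨$⟩ʳ opposite i ≡ a
      reversed {i} πi≡a = trans (cong (π ⟨$⟩ʳ_) (Finₚ.opposite-involutive i)) πi≡a

open Cones

open import Data.Nat using (ℕ; suc; _+_)
open import Data.Fin using (Fin; zero; suc; lift; opposite; fromℕ)
open import Data.Fin.Permutation using (Permutation′; _⟨$⟩ʳ_; remove; lift₀-remove; reverse; _∘ₚ_)
open import Data.Fin.Properties using (opposite-involutive)
open import Data.Product using (Σ; _×_; _,_; map₂)
open import Data.Sum using (_⊎_; [_,_]′) renaming (map to ⊎-map)
open import Function using (_∘_)
open import Function.Bundles using (_⇔_; mk⇔)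
open import Relation.Binary.PropositionalEquality using (_≡_; refl; sym; trans; cong)

embed≗lift : ∀ {n} (σ : Permutation′ n) i → embed σ i ≡ lift 1 (σ ⟨$⟩ʳ_) i
embed≗lift σ zero    = refl
embed≗lift σ (suc i) = refl

fixes-zero⇒embed : ∀ {n} (π : Permutation′ (suc n)) → π ⟨$⟩ʳ zero ≡ zero → ∀ i → π ⟨$⟩ʳ i ≡ embed (remove zero π) i
fixes-zero⇒embed π π₀≡0 zero    = π₀≡0
fixes-zero⇒embed π π₀≡0 (suc i) = sym (lift₀-remove π π₀≡0 (suc i))

W-remove-zero : ∀ {k} (w : Permutation′ (2 + k)) → W (1 + k) w → w ⟨$⟩ʳ zero ≡ zero →
                Σ (Permutation′ (1 + k)) λ σ → W k σ × ((i : Fin (2 + k)) → w ⟨$⟩ʳ i ≡ embed σ i)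
W-remove-zero w w∈W w₀≡0 =
  σ , covers-unlift {f = σ ⟨$⟩ʳ_} (covers-resp w≗liftσ w∈W) , fixes-zero⇒embed w w₀≡0
  where
  σ = remove zero w
  w≗liftσ : ∀ i → w ⟨$⟩ʳ i ≡ lift 1 (σ ⟨$⟩ʳ_) i
  w≗liftσ i = trans (fixes-zero⇒embed w w₀≡0 i) (embed≗lift σ i)

W-remove-zero-reversed : ∀ {k} (w : Permutation′ (2 + k)) → W (1 + k) w → w ⟨$⟩ʳ fromℕ (1 + k) ≡ zero →
                         Σ (Permutation′ (1 + k)) λ σ → W k σ × ((i : Fin (2 + k)) → w ⟨$⟩ʳ i ≡ embed σ (w₀ i))
W-remove-zero-reversed w w∈W wN≡0 =
  map₂ (map₂ (λ w̄≗σ i → trans (cong (w ⟨$⟩ʳ_) (sym (opposite-involutive i))) (w̄≗σ (opposite i))))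
       (W-remove-zero (reverse ∘ₚ w) (covers-reverse {f = w ⟨$⟩ʳ_} w∈W) wN≡0)

embed-covers : ∀ {k} (σ : Permutation′ (1 + k)) → W k σ → Covers (1 + k) (embed σ)
embed-covers σ σ∈W = covers-resp (sym ∘ embed≗lift σ) (covers-lift {f = σ ⟨$⟩ʳ_} σ∈W)

lemma4p4 : (m : ℕ) → (w : Permutation′ (3 + m)) →
    W (2 + m) w ⇔
      ((Σ (Permutation′ (2 + m)) λ σ → W (1 + m) σ × ((i : Fin (3 + m)) → w ⟨$⟩ʳ i ≡ embed σ i))
       ⊎ (Σ (Permutation′ (2 + m)) λ σ → W (1 + m) σ × ((i : Fin (3 + m)) → w ⟨$⟩ʳ i ≡ embed σ (w₀ i))))
lemma4p4 m w = mk⇔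
  (λ w∈W → ⊎-map (W-remove-zero w w∈W) (W-remove-zero-reversed w w∈W) (covers⇒zero-at-end w w∈W))
  [ (λ (σ , σ∈W , w≗σ) → covers-resp (sym ∘ w≗σ) (embed-covers σ σ∈W))
  , (λ (σ , σ∈W , w≗σw₀) → covers-resp (sym ∘ w≗σw₀) (covers-reverse {f = embed σ} (embed-covers σ σ∈W))) ]′
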